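{- The Möbius function of $\mathcal{G}$ is unbounded: for every $N$ there exist graphs $H\le G$ with $|\mu(H,G)|>N$.
   Context: $\mathcal{G}$ is the poset of all finite unlabelled graphs (loops and multiple edges allowed), up to isomorphism, with $H\le G$ iff $H$ is isomorphic to an induced subgraph of $G$. $\mu$ is its Möbius function: $\mu(a,a)=1$, $\mu(a,b)=0$ if $a\not\le b$, and $\mu(a,b)=-\sum_{a\le c<b}\mu(a,c)$ if $a<b$. -}

module Defs where

open import Data.Nat as ℕ using (ℕ; zero; suc; _<_; _≡ᵇ_)
open import Data.Integer as ℤ using (ℤ; +_; -_)
open import Data.Bool using (Bool; true; false; _∧_; not; if_then_else_)
open import Data.Fin using (Fin; zero; suc; _≟_)
open import Data.List using (List; []; _∷_; map; concatMap; allFin; upTo; foldr)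

allᵇ : {A : Set} → (A → Bool) → List A → Bool
allᵇ p = foldr (λ x b → p x ∧ b) true

anyᵇ : {A : Set} → (A → Bool) → List A → Bool
anyᵇ p = foldr (λ x b → if p x then true else b) false

filterᵇ : {A : Set} → (A → Bool) → List A → List A
filterᵇ p = foldr (λ x xs → if p x then x ∷ xs else xs) []
open import Data.Product using (Σ; _×_; _,_)
open import Relation.Binary.PropositionalEquality using (_≡_; _≢_)
open import Relation.Nullary.Decidable using (⌊_⌋)
open import Function.Definitions using (Injective)

-- Finite graphs, loops and multiple edges allowed.
-- Vertices are Fin n; adj i j is the number of edges between i and j
-- (adj i i = number of loops at i); adjacency is symmetric.

record Graph : Set where
  field
    n   : ℕ
    adj : Fin n → Fin n → ℕ
    sym : ∀ i j → adj i j ≡ adj j i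
open Graph public

_≤G_ : Graph → Graph → Set
H ≤G G = Σ (Fin (n H) → Fin (n G)) λ f →
           Injective _≡_ _≡_ f × (∀ i j → adj H i j ≡ adj G (f i) (f j))

maps : (m k : ℕ) → List (Fin m → Fin k)
maps zero    k = (λ ()) ∷ []
maps (suc m) k = concatMap (λ f → map (λ x → λ { zero → x ; (suc i) → f i }) (allFin k)) (maps m k)

injective? : ∀ {m k} → (Fin m → Fin k) → Bool
injective? {m} f = allᵇ (λ i → allᵇ (λ j → ⌊ i ≟ j ⌋ ∨' not ⌊ f i ≟ f j ⌋) (allFin m)) (allFin m)
  where
  _∨'_ : Bool → Bool → Bool
  true  ∨' _ = true
  false ∨' b = b

surjective? : ∀ {m k} → (Fin m → Fin k) → Bool
surjective? {m} {k} f = allᵇ (λ y → anyᵇ (λ x → ⌊ f x ≟ y ⌋) (allFin m)) (allFin k)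

preserves? : (H G : Graph) → (Fin (n H) → Fin (n G)) → Bool
preserves? H G f = allᵇ (λ i → allᵇ (λ j → adj H i j ≡ᵇ adj G (f i) (f j)) (allFin (n H))) (allFin (n H))

embeds? : Graph → Graph → Bool
embeds? H G = anyᵇ (λ f → injective? f ∧ preserves? H G f) (maps (n H) (n G))

iso? : Graph → Graph → Bool
iso? H G = anyᵇ (λ f → injective? f ∧ surjective? f ∧ preserves? H G f) (maps (n H) (n G))

induced : (G : Graph) {k : ℕ} → (Fin k → Fin (n G)) → Graph
induced G {k} f = record { n = k ; adj = λ i j → adj G (f i) (f j) ; sym = λ i j → sym G (f i) (f j) }

properInduced : Graph → List Graph
properInduced G =
  concatMap (λ k → map (induced G) (filterᵇ injective? (maps k (n G)))) (upTo (n G))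

nubIso : List Graph → List Graph
nubIso = foldr (λ x acc → if anyᵇ (iso? x) acc then acc else x ∷ acc) []

sumℤ : List ℤ → ℤ
sumℤ = foldr ℤ._+_ (+ 0)

-- The elements c with H ≤ c < G are (up to isomorphism) the induced
-- subgraphs of G on fewer vertices that contain a copy of H; we sum over
-- one representative per isomorphism class.  The fuel argument bounds the
-- recursion depth; suc (n G) is always enough since vertex count drops.

μ′ : ℕ → Graph → Graph → ℤ
μ′ zero       H G = + 0
μ′ (suc fuel) H G =
  if iso? H G then + 1
  else if not (embeds? H G) then + 0
  else - sumℤ (map (μ′ fuel H) (nubIso (filterᵇ (embeds? H) (properInduced G))))

μ : Graph → Graph → ℤ
μ H G = μ′ (suc (n G)) H G

-- Take H = edgeless p, the edgeless graph on p vertices, and G = star p, a star with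
-- p + 1 leaves whose edges to the centre have pairwise distinct multiplicities.  A graph
-- strictly between H and G is an induced subgraph on p or p + 1 vertices containing p
-- independent vertices: on p vertices it is H itself, with μ = 1; on p + 1 vertices it
-- covers only H, so μ = -1.  Deleting the different leaves of G gives p + 1 pairwise
-- non-isomorphic such coatoms, since each lacks exactly its own leaf multiplicity, hence
-- |μ(H , G)| = #coatoms - 1 ≥ p.

module Submission where

open import Data.Bool using (Bool; true; false; not; T)
open import Data.Bool.Properties using (T-∧)
open import Data.Fin using (Fin; zero; suc; _≟_; punchIn; punchOut; toℕ)
import Data.Fin.Properties as Finₚ
open import Data.Integer as ℤ using (ℤ; +_; -_; ∣_∣; _⊖_)
import Data.Integer.Properties as ℤₚ
open import Data.List using (List; []; _∷_; map; length; lookup; allFin; upTo)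
open import Data.List.Membership.Propositional using (_∈_; find; lose)
open import Data.List.Membership.Propositional.Properties
  using (∈-allFin; ∈-map⁺; ∈-map⁻; ∈-concatMap⁺; ∈-concatMap⁻; ∈-upTo⁺; ∈-upTo⁻)
open import Data.List.Relation.Unary.Any as Any using (Any; here; there)
import Data.List.Relation.Unary.Any.Properties as Anyₚ
open import Data.Nat as ℕ using (ℕ; zero; suc; _≤_; _<_; _∸_; z≤n; s≤s)
import Data.Nat.Properties as ℕₚ
open import Data.Product using (Σ; ∃; _×_; _,_; proj₁; proj₂; map₁)
open import Data.Sum using (_⊎_; inj₁; inj₂)
open import Function using (_∘_; id)
open import Function.Bundles using (Equivalence)
open import Function.Definitions using (Injective; StrictlySurjective)
open import Relation.Binary.PropositionalEquality as ≡
  using (_≡_; _≢_; _≗_; refl; trans; cong; cong₂; subst)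
open import Relation.Nullary using (¬_; yes; no; contradiction)
open import Relation.Nullary.Decidable using (⌊_⌋; T?; toWitness; fromWitness; toWitnessFalse)

open import Defs

module _ {A : Set} (p : A → Bool) where

  anyᵇ⁺ : ∀ {xs} → Any (T ∘ p) xs → T (anyᵇ p xs)
  anyᵇ⁺ {x ∷ xs} (here px) with p x
  ... | true  = _
  anyᵇ⁺ {x ∷ xs} (there pxs) with p x
  ... | true  = _
  ... | false = anyᵇ⁺ pxs

  anyᵇ⁻ : ∀ xs → T (anyᵇ p xs) → Any (T ∘ p) xs
  anyᵇ⁻ (x ∷ xs) any with p x in px
  ... | true  = here (subst T (≡.sym px) _)
  ... | false = there (anyᵇ⁻ xs any)

  allᵇ⁺ : ∀ xs → (∀ {x} → x ∈ xs → T (p x)) → T (allᵇ p xs)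
  allᵇ⁺ []       _   = _
  allᵇ⁺ (x ∷ xs) all with p x | all (here refl)
  ... | true | _ = allᵇ⁺ xs (all ∘ there)

  allᵇ⁻ : ∀ {xs x} → T (allᵇ p xs) → x ∈ xs → T (p x)
  allᵇ⁻ {y ∷ xs} all x∈ with p y in py | x∈
  ... | true | here refl = subst T (≡.sym py) _
  ... | true | there x∈′ = allᵇ⁻ all x∈′

  allᵇ-counterexample : ∀ xs → ¬ T (allᵇ p xs) → Any (¬_ ∘ T ∘ p) xs
  allᵇ-counterexample []       ¬all = contradiction _ ¬all
  allᵇ-counterexample (x ∷ xs) ¬all with p x in px
  ... | true  = there (allᵇ-counterexample xs ¬all)
  ... | false = here (subst (¬_ ∘ T) (≡.sym px) id)

  filterᵇ⁺ : ∀ {xs x} → x ∈ xs → T (p x) → x ∈ filterᵇ p xs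
  filterᵇ⁺ {y ∷ xs} x∈ px with p y in py | x∈
  ... | true  | here refl = here refl
  ... | true  | there x∈′ = there (filterᵇ⁺ x∈′ px)
  ... | false | here refl = contradiction (subst T py px) id
  ... | false | there x∈′ = filterᵇ⁺ x∈′ px

  filterᵇ⁻ : ∀ {xs x} → x ∈ filterᵇ p xs → x ∈ xs × T (p x)
  filterᵇ⁻ {y ∷ xs} x∈ with p y in py | x∈
  ... | true  | here refl = here refl , subst T (≡.sym py) _
  ... | true  | there x∈′ = map₁ there (filterᵇ⁻ x∈′)
  ... | false | x∈′       = map₁ there (filterᵇ⁻ x∈′)

maps-complete : ∀ m k (f : Fin m → Fin k) → Any (_≗ f) (maps m k)
maps-complete zero    k f = here λ ()
maps-complete (suc m) k f =
  Anyₚ.concatMap⁺ _ (Any.map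
    (λ g≗ → Anyₚ.map⁺ (Any.map (λ { refl → λ { zero → refl ; (suc i) → g≗ i } })
                                (∈-allFin (f zero))))
    (maps-complete m k (f ∘ suc)))

PreservesAdj : (H G : Graph) → (Fin (n H) → Fin (n G)) → Set
PreservesAdj H G f = ∀ i j → adj H i j ≡ adj G (f i) (f j)

_≅_ : Graph → Graph → Set
H ≅ G = Σ (Fin (n H) → Fin (n G)) λ f →
          Injective _≡_ _≡_ f × StrictlySurjective _≡_ f × PreservesAdj H G f

module _ {m k} (f : Fin m → Fin k) where

  injective?⇒injective : T (injective? f) → Injective _≡_ _≡_ f
  injective?⇒injective inj? {i} {j} fi≡fj
    with i ≟ j | f i ≟ f j | allᵇ⁻ _ (allᵇ⁻ _ inj? (∈-allFin i)) (∈-allFin j)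
  ... | yes i≡j | _        | _ = i≡j
  ... | no _    | no fi≢fj | _ = contradiction fi≡fj fi≢fj

  injective⇒injective? : Injective _≡_ _≡_ f → T (injective? f)
  injective⇒injective? inj with T? (injective? f)
  ... | yes inj? = inj?
  ... | no ¬inj? with find (allᵇ-counterexample _ (allFin m) ¬inj?)
  ... | i , _ , ¬row with find (allᵇ-counterexample _ (allFin m) ¬row)
  ... | j , _ , ¬ok with i ≟ j | f i ≟ f j | ¬ok
  ... | yes _ | _         | ¬ok′ = contradiction _ ¬ok′
  ... | no i≢j | yes fi≡fj | _   = contradiction (inj fi≡fj) i≢j
  ... | no _  | no _      | ¬ok′ = contradiction _ ¬ok′

  surjective?⇒surjective : T (surjective? f) → StrictlySurjective _≡_ f
  surjective?⇒surjective surj? y =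
    let i , _ , fi≡y = find (anyᵇ⁻ _ (allFin m) (allᵇ⁻ _ surj? (∈-allFin y)))
    in i , toWitness fi≡y

  surjective⇒surjective? : StrictlySurjective _≡_ f → T (surjective? f)
  surjective⇒surjective? surj = allᵇ⁺ _ (allFin k) λ {y} _ →
    let i , fi≡y = surj y in anyᵇ⁺ _ (lose (∈-allFin i) (fromWitness fi≡y))

module _ (H G : Graph) (f : Fin (n H) → Fin (n G)) where

  preserves?⇒preserves : T (preserves? H G f) → PreservesAdj H G f
  preserves?⇒preserves pres? i j =
    ℕₚ.≡ᵇ⇒≡ _ _ (allᵇ⁻ _ (allᵇ⁻ _ pres? (∈-allFin i)) (∈-allFin j))

  preserves⇒preserves? : PreservesAdj H G f → T (preserves? H G f)
  preserves⇒preserves? pres = allᵇ⁺ _ (allFin (n H)) λ {i} _ →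
    allᵇ⁺ _ (allFin (n H)) λ {j} _ → ℕₚ.≡⇒≡ᵇ _ _ (pres i j)

module _ {m k} {f g : Fin m → Fin k} (g≗f : g ≗ f) where

  injective-≗ : Injective _≡_ _≡_ f → Injective _≡_ _≡_ g
  injective-≗ inj {i} {j} gi≡gj = inj (trans (≡.sym (g≗f i)) (trans gi≡gj (g≗f j)))

  surjective-≗ : StrictlySurjective _≡_ f → StrictlySurjective _≡_ g
  surjective-≗ surj y = let i , fi≡y = surj y in i , trans (g≗f i) fi≡y

module _ (H G : Graph) {f g : Fin (n H) → Fin (n G)} (g≗f : g ≗ f) where

  preserves-≗ : PreservesAdj H G f → PreservesAdj H G g
  preserves-≗ pres i j = trans (pres i j) (≡.sym (cong₂ (adj G) (g≗f i) (g≗f j)))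

module _ (H G : Graph) where

  embeds?⇒≤G : T (embeds? H G) → H ≤G G
  embeds?⇒≤G embeds =
    let f , _ , ok = find (anyᵇ⁻ _ (maps (n H) (n G)) embeds)
        inj? , pres? = Equivalence.to T-∧ ok
    in f , injective?⇒injective f inj? , preserves?⇒preserves H G f pres?

  ≤G⇒embeds? : H ≤G G → T (embeds? H G)
  ≤G⇒embeds? (f , inj , pres) =
    let g , g∈ , g≗f = find (maps-complete (n H) (n G) f)
    in anyᵇ⁺ _ (lose g∈ (Equivalence.from T-∧
         (injective⇒injective? g (injective-≗ g≗f inj) ,
          preserves⇒preserves? H G g (preserves-≗ H G g≗f pres))))

  iso?⇒≅ : T (iso? H G) → H ≅ G
  iso?⇒≅ iso =
    let f , _ , ok = find (anyᵇ⁻ _ (maps (n H) (n G)) iso)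
        inj? , ok′ = Equivalence.to T-∧ ok
        surj? , pres? = Equivalence.to T-∧ ok′
    in f , injective?⇒injective f inj? , surjective?⇒surjective f surj? ,
       preserves?⇒preserves H G f pres?

  ≅⇒iso? : H ≅ G → T (iso? H G)
  ≅⇒iso? (f , inj , surj , pres) =
    let g , g∈ , g≗f = find (maps-complete (n H) (n G) f)
    in anyᵇ⁺ _ (lose g∈ (Equivalence.from T-∧
         (injective⇒injective? g (injective-≗ g≗f inj) ,
          Equivalence.from T-∧
            (surjective⇒surjective? g (surjective-≗ g≗f surj) ,
             preserves⇒preserves? H G g (preserves-≗ H G g≗f pres)))))

≤G⇒≤ : ∀ {H G} → H ≤G G → n H ≤ n G
≤G⇒≤ (_ , inj , _) = Finₚ.injective⇒≤ inj

≅⇒≡ : ∀ {H G} → H ≅ G → n H ≡ n G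
≅⇒≡ (f , inj , surj , _) = Finₚ.cantor-schröder-bernstein inj section-injective
  where
  section-injective : Injective _≡_ _≡_ (proj₁ ∘ surj)
  section-injective {x} {y} eq =
    trans (≡.sym (proj₂ (surj x))) (trans (cong f eq) (proj₂ (surj y)))

≅-refl : ∀ {G} → G ≅ G
≅-refl = id , id , (λ y → y , refl) , λ _ _ → refl

injective⇒surjective : ∀ {a b} {f : Fin a → Fin b} →
                       Injective _≡_ _≡_ f → b ≤ a → StrictlySurjective _≡_ f
injective⇒surjective {a} {suc b} {f} inj b≤a y with Finₚ.any? (λ x → f x ≟ y)
... | yes hit = hit
... | no miss = contradiction (Finₚ.injective⇒≤ punchedOut-injective) (ℕₚ.<⇒≱ b≤a)
  where
  avoids : ∀ x → y ≢ f x
  avoids x y≡fx = miss (x , ≡.sym y≡fx)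
  punchedOut-injective : Injective _≡_ _≡_ (λ x → punchOut (avoids x))
  punchedOut-injective {i} {j} eq = inj (Finₚ.punchOut-injective (avoids i) (avoids j) eq)

edgeless : ℕ → Graph
edgeless p = record { n = p ; adj = λ _ _ → 0 ; sym = λ _ _ → refl }

IsEdgeless : Graph → Set
IsEdgeless G = ∀ i j → adj G i j ≡ 0

edgeless-≤G⇒isEdgeless : ∀ {p G} → edgeless p ≤G G → n G ≤ p → IsEdgeless G
edgeless-≤G⇒isEdgeless {G = G} (f , inj , pres) nG≤p i j =
  let i′ , fi′≡i = injective⇒surjective inj nG≤p i
      j′ , fj′≡j = injective⇒surjective inj nG≤p j
  in trans (≡.sym (cong₂ (adj G) fi′≡i fj′≡j)) (≡.sym (pres i′ j′))

isEdgeless⇒≅ : ∀ {H G} → n H ≡ n G → IsEdgeless H → IsEdgeless G → H ≅ G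
isEdgeless⇒≅ {record { n = m }} {record { n = .m }} refl H₀ G₀ =
  id , id , (λ y → y , refl) , λ i j → trans (H₀ i j) (≡.sym (G₀ i j))

edgeless-≤G⇒≡ : ∀ {p} G → edgeless p ≤G G → n G ≤ p → n G ≡ p
edgeless-≤G⇒≡ {p} G emb nG≤p = ℕₚ.≤-antisym nG≤p (≤G⇒≤ {edgeless p} {G} emb)

nubIso-⊆ : ∀ L {y} → y ∈ nubIso L → y ∈ L
nubIso-⊆ (x ∷ L) y∈ with anyᵇ (iso? x) (nubIso L) | y∈
... | true  | y∈′       = there (nubIso-⊆ L y∈′)
... | false | here refl = here refl
... | false | there y∈′ = there (nubIso-⊆ L y∈′)

nubIso-covers : ∀ L {x} → x ∈ L → Any (T ∘ iso? x) (nubIso L)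
nubIso-covers (z ∷ L) x∈ with anyᵇ (iso? z) (nubIso L) in covered | x∈
... | true  | here refl = anyᵇ⁻ _ _ (subst T (≡.sym covered) _)
... | true  | there x∈′ = nubIso-covers L x∈′
... | false | here refl = here (≅⇒iso? z z (≅-refl {z}))
... | false | there x∈′ = there (nubIso-covers L x∈′)

nubIso-filter-length≤1 : ∀ (S : Graph → Bool) L →
  (∀ {x y} → x ∈ L → y ∈ L → T (S x) → T (S y) → T (iso? x y)) →
  length (filterᵇ S (nubIso L)) ≤ 1
nubIso-filter-length≤1 S []      _     = z≤n
nubIso-filter-length≤1 S (z ∷ L) S-iso with anyᵇ (iso? z) (nubIso L) in covered
... | true  = nubIso-filter-length≤1 S L (λ x∈ y∈ → S-iso (there x∈) (there y∈))
... | false with S z in Sz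
...   | false = nubIso-filter-length≤1 S L (λ x∈ y∈ → S-iso (there x∈) (there y∈))
...   | true with filterᵇ S (nubIso L) in rest
...     | []    = ℕₚ.≤-refl
...     | y ∷ _ =
  let y∈ , Sy = filterᵇ⁻ S (subst (y ∈_) (≡.sym rest) (here refl))
      z≅y = S-iso (here refl) (there (nubIso-⊆ L y∈)) (subst T (≡.sym Sz) _) Sy
  in contradiction (anyᵇ⁺ _ (lose y∈ z≅y)) (subst T covered)

count : {A : Set} → (A → Bool) → List A → ℕ
count B xs = length (filterᵇ B xs)

count-false : ∀ {A : Set} (xs : List A) → count (λ _ → false) xs ≡ 0
count-false []       = refl
count-false (_ ∷ xs) = count-false xs

sumℤ-signs : ∀ {A : Set} (h : A → ℤ) (B : A → Bool) xs →
  (∀ {x} → x ∈ xs → T (B x) → h x ≡ - + 1) →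
  (∀ {x} → x ∈ xs → T (not (B x)) → h x ≡ + 1) →
  sumℤ (map h xs) ≡ count (not ∘ B) xs ⊖ count B xs
sumℤ-signs h B []       _   _   = refl
sumℤ-signs h B (x ∷ xs) neg pos
  with B x in Bx | sumℤ-signs h B xs (neg ∘ there) (pos ∘ there)
... | true  | rest = trans (cong₂ ℤ._+_ (neg (here refl) (subst T (≡.sym Bx) _)) rest)
                           (ℤₚ.distribʳ-⊖-+-neg 0 (count (not ∘ B) xs) (count B xs))
... | false | rest = trans (cong₂ ℤ._+_ (pos (here refl) (subst (T ∘ not) (≡.sym Bx) _)) rest)
                           (ℤₚ.distribʳ-⊖-+-pos 1 (count (not ∘ B) xs) (count B xs))

witnesses⇒≤length : ∀ {A : Set} {K} {xs : List A} (P : Fin K → A → Set) →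
  (∀ {j j′ x} → P j x → P j′ x → j ≡ j′) → (∀ j → Any (P j) xs) → K ≤ length xs
witnesses⇒≤length {xs = xs} P unique witness = Finₚ.injective⇒≤ {f = Any.index ∘ witness}
  λ {j} {j′} same-index → unique (Anyₚ.lookup-index (witness j))
    (subst (P j′ ∘ lookup xs) (≡.sym same-index) (Anyₚ.lookup-index (witness j′)))

properInduced-size : ∀ G {x} → x ∈ properInduced G → n x < n G
properInduced-size G x∈ =
  let k , k∈ , x∈ₖ = find (∈-concatMap⁻ _ {xs = upTo (n G)} x∈)
      _ , _ , x≡ = ∈-map⁻ (induced G) x∈ₖ
  in subst (_< n G) (≡.sym (cong n x≡)) (∈-upTo⁻ k∈)

intervalCopies : Graph → Graph → List Graph
intervalCopies H G = filterᵇ (embeds? H) (properInduced G)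

intervalReps : Graph → Graph → List Graph
intervalReps H G = nubIso (intervalCopies H G)

∈-intervalCopies : ∀ H G {y} → y ∈ intervalCopies H G → n y < n G × H ≤G y
∈-intervalCopies H G {y} y∈ =
  let y∈′ , embeds = filterᵇ⁻ (embeds? H) y∈
  in properInduced-size G {y} y∈′ , embeds?⇒≤G H y embeds

induced∈properInduced : ∀ G {k} {f : Fin k → Fin (n G)} → Injective _≡_ _≡_ f → k < n G →
                        ∃ λ g → g ≗ f × induced G g ∈ properInduced G
induced∈properInduced G {k} {f} inj k<n =
  let g , g∈ , g≗f = find (maps-complete k (n G) f)
      g-inj = injective⇒injective? g (injective-≗ g≗f inj)
  in g , g≗f , ∈-concatMap⁺ _ (lose (∈-upTo⁺ k<n) (∈-map⁺ (induced G) (filterᵇ⁺ _ g∈ g-inj)))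

induced-≗ : ∀ G {k} {f g : Fin k → Fin (n G)} → g ≗ f →
            PreservesAdj (induced G f) (induced G g) id
induced-≗ G g≗f i j = cong₂ (adj G) (≡.sym (g≗f i)) (≡.sym (g≗f j))

induced-represented : ∀ H G {k} {f : Fin k → Fin (n G)} → Injective _≡_ _≡_ f → k < n G →
                      H ≤G induced G f → Any (induced G f ≅_) (intervalReps H G)
induced-represented H G {f = f} inj k<n (e , e-inj , e-pres) =
  let g , g≗f , copy∈ = induced∈properInduced G inj k<n
      H≤copy : H ≤G induced G g
      H≤copy = e , e-inj , λ i j → trans (e-pres i j) (induced-≗ G g≗f (e i) (e j))
      retarget : ∀ {y} → induced G g ≅ y → induced G f ≅ y
      retarget (h , h-inj , h-surj , h-pres) =
        h , h-inj , h-surj , λ i j → trans (induced-≗ G g≗f i j) (h-pres i j)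
  in Any.map (λ {y} → retarget {y} ∘ iso?⇒≅ (induced G g) y)
       (nubIso-covers (intervalCopies H G) (filterᵇ⁺ _ copy∈ (≤G⇒embeds? H (induced G g) H≤copy)))

<⇒¬iso? : ∀ {H G} → n H < n G → ¬ T (iso? H G)
<⇒¬iso? {H} {G} nH<nG iso = ℕₚ.<-irrefl (≅⇒≡ {H} {G} (iso?⇒≅ H G iso)) nH<nG

edgeless-≤G⇒≅ : ∀ {p x y} → n x ≡ p → n y ≡ p → edgeless p ≤G x → edgeless p ≤G y → x ≅ y
edgeless-≤G⇒≅ {p} {x} {y} nx≡p ny≡p x-emb y-emb = isEdgeless⇒≅ {x} {y} (trans nx≡p (≡.sym ny≡p))
  (edgeless-≤G⇒isEdgeless {p} {x} x-emb (ℕₚ.≤-reflexive nx≡p))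
  (edgeless-≤G⇒isEdgeless {p} {y} y-emb (ℕₚ.≤-reflexive ny≡p))

μ′-unfold : ∀ fuel {H G} → ¬ T (iso? H G) → H ≤G G →
            μ′ (suc fuel) H G ≡ - sumℤ (map (μ′ fuel H) (intervalReps H G))
μ′-unfold fuel {H} {G} ¬iso H≤G with iso? H G | embeds? H G | ≤G⇒embeds? H G H≤G
... | true  | _    | _ = contradiction _ ¬iso
... | false | true | _ = refl

μ′-bottom : ∀ fuel {p y} → n y ≡ p → edgeless p ≤G y → μ′ (suc fuel) (edgeless p) y ≡ + 1
μ′-bottom fuel {p} {y} ny≡p emb
  with iso? (edgeless p) y
     | ≅⇒iso? (edgeless p) y
         (edgeless-≤G⇒≅ {p} {edgeless p} {y} refl ny≡p (id , id , λ _ _ → refl) emb)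
... | true | _ = refl

μ′-coatom : ∀ fuel {p x} → n x ≡ suc p → edgeless p ≤G x →
            μ′ (suc (suc fuel)) (edgeless p) x ≡ - + 1
μ′-coatom fuel {p} {x} nx≡1+p x-emb@(e , e-inj , e-pres) = begin
  μ′ (suc (suc fuel)) (edgeless p) x
    ≡⟨ μ′-unfold (suc fuel) {edgeless p} {x} (<⇒¬iso? {edgeless p} {x} p<nx) x-emb ⟩
  - sumℤ (map (μ′ (suc fuel) (edgeless p)) R)
    ≡⟨ cong -_ (sumℤ-signs _ (λ _ → false) R (λ _ ()) (λ y∈ _ → bottom (nubIso-⊆ L y∈))) ⟩
  - (count (λ _ → true) R ⊖ count (λ _ → false) R)
    ≡⟨ cong₂ (λ a b → - (a ⊖ b)) one-rep (count-false R) ⟩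
  - + 1
    ∎
  where
  open ≡.≡-Reasoning
  L R : List Graph
  L = intervalCopies (edgeless p) x
  R = intervalReps (edgeless p) x
  p<nx : p < n x
  p<nx = subst (p <_) (≡.sym nx≡1+p) (ℕₚ.n<1+n p)
  above : ∀ {y} → y ∈ L → n y < n x × edgeless p ≤G y
  above {y} = ∈-intervalCopies (edgeless p) x {y}
  size : ∀ {y} → y ∈ L → n y ≡ p
  size {y} y∈ = edgeless-≤G⇒≡ y (proj₂ (above y∈))
    (ℕₚ.m<1+n⇒m≤n (subst (n y <_) nx≡1+p (proj₁ (above y∈))))
  bottom : ∀ {y} → y ∈ L → μ′ (suc fuel) (edgeless p) y ≡ + 1
  bottom {y} y∈ = μ′-bottom fuel {p} {y} (size y∈) (proj₂ (above y∈))
  one-rep : count (λ _ → true) R ≡ 1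
  one-rep = ℕₚ.≤-antisym
    (nubIso-filter-length≤1 _ L λ {y} {z} y∈ z∈ _ _ → ≅⇒iso? y z
      (edgeless-≤G⇒≅ {p} {y} {z} (size y∈) (size z∈)
        (proj₂ (above y∈)) (proj₂ (above z∈))))
    (let y , y∈ , _ = find (induced-represented (edgeless p) x e-inj p<nx (id , id , e-pres))
     in ℕₚ.≤-trans (s≤s z≤n) (Finₚ.toℕ<n (Any.index (filterᵇ⁺ (λ _ → true) {R} {y} y∈ _))))

HasMultiplicity : Graph → ℕ → Set
HasMultiplicity G v = ∃ λ i → ∃ λ j → adj G i j ≡ v

≅⇒hasMultiplicity : ∀ {H G v} → H ≅ G → HasMultiplicity H v → HasMultiplicity G v
≅⇒hasMultiplicity (f , _ , _ , pres) (i , j , e) = f i , f j , trans (≡.sym (pres i j)) e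

≅⇒hasMultiplicity⁻ : ∀ {H G v} → H ≅ G → HasMultiplicity G v → HasMultiplicity H v
≅⇒hasMultiplicity⁻ {G = G} (f , _ , surj , pres) (i , j , e) =
  let i′ , fi′≡i = surj i
      j′ , fj′≡j = surj j
  in i′ , j′ , trans (pres i′ j′) (trans (cong₂ (adj G) fi′≡i fj′≡j) e)

-- Leaf w (vertex suc w) is joined to the centre zero by toℕ w + 1 parallel edges,
-- so that deleting different leaves leaves non-isomorphic graphs.
starAdj : ∀ {m} → Fin (suc m) → Fin (suc m) → ℕ
starAdj zero    (suc w) = suc (toℕ w)
starAdj (suc w) zero    = suc (toℕ w)
starAdj _       _       = 0

starAdj-sym : ∀ {m} (u v : Fin (suc m)) → starAdj u v ≡ starAdj v u
starAdj-sym zero    zero    = refl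
starAdj-sym zero    (suc _) = refl
starAdj-sym (suc _) zero    = refl
starAdj-sym (suc _) (suc _) = refl

star : ℕ → Graph
star p = record { n = suc (suc p) ; adj = starAdj ; sym = starAdj-sym }

starAdj≡leaf⇒incident : ∀ {m} {u v : Fin (suc m)} w →
                         starAdj u v ≡ suc (toℕ w) → u ≡ suc w ⊎ v ≡ suc w
starAdj≡leaf⇒incident {u = zero}  {suc v} w e =
  inj₂ (cong suc (Finₚ.toℕ-injective (ℕₚ.suc-injective e)))
starAdj≡leaf⇒incident {u = suc u} {zero}  w e =
  inj₁ (cong suc (Finₚ.toℕ-injective (ℕₚ.suc-injective e)))

starWithout : ∀ p → Fin (suc p) → Graph
starWithout p w = induced (star p) (punchIn (suc w))

MissesOnlyLeaf : ∀ {p} → Fin (suc p) → Graph → Set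
MissesOnlyLeaf w G =
  ¬ HasMultiplicity G (suc (toℕ w)) × (∀ {w′} → w′ ≢ w → HasMultiplicity G (suc (toℕ w′)))

missesOnlyLeaf-unique : ∀ {p} {w w′ : Fin (suc p)} {G} →
                        MissesOnlyLeaf w G → MissesOnlyLeaf w′ G → w ≡ w′
missesOnlyLeaf-unique {w = w} {w′} (lacks , _) (_ , has) with w ≟ w′
... | yes w≡w′ = w≡w′
... | no w≢w′  = contradiction (has w≢w′) lacks

≅⇒missesOnlyLeaf : ∀ {p} {w : Fin (suc p)} {H G} → H ≅ G → MissesOnlyLeaf w H → MissesOnlyLeaf w G
≅⇒missesOnlyLeaf {H = H} {G} H≅G (lacks , has) =
  lacks ∘ ≅⇒hasMultiplicity⁻ {H} {G} H≅G , ≅⇒hasMultiplicity {H} {G} H≅G ∘ has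

starWithout-missesOnlyLeaf : ∀ p w → MissesOnlyLeaf w (starWithout p w)
starWithout-missesOnlyLeaf p w = lacks , has
  where
  lacks : ¬ HasMultiplicity (starWithout p w) (suc (toℕ w))
  lacks (i , j , e) with starAdj≡leaf⇒incident w e
  ... | inj₁ hit = Finₚ.punchInᵢ≢i (suc w) i hit
  ... | inj₂ hit = Finₚ.punchInᵢ≢i (suc w) j hit
  has : ∀ {w′} → w′ ≢ w → HasMultiplicity (starWithout p w) (suc (toℕ w′))
  has w′≢w = zero , punchOut leaf≢ , cong (starAdj zero) (Finₚ.punchIn-punchOut leaf≢)
    where
    leaf≢ : suc w ≢ suc _
    leaf≢ = w′≢w ∘ ≡.sym ∘ Finₚ.suc-injective

module _ (p : ℕ) where

  private
    L R : List Graph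
    L = intervalCopies (edgeless p) (star p)
    R = intervalReps (edgeless p) (star p)

    above : ∀ {y} → y ∈ L → n y < suc (suc p) × edgeless p ≤G y
    above {y} = ∈-intervalCopies (edgeless p) (star p) {y}

  isCoatom : Graph → Bool
  isCoatom y = ⌊ n y ℕ.≟ suc p ⌋

  private
    bottom-size : ∀ {y} → y ∈ L → T (not (isCoatom y)) → n y ≡ p
    bottom-size {y} y∈ ¬coatom = edgeless-≤G⇒≡ y (proj₂ (above y∈))
      (ℕₚ.m<1+n⇒m≤n (ℕₚ.≤∧≢⇒< (ℕₚ.m<1+n⇒m≤n (proj₁ (above y∈))) (toWitnessFalse ¬coatom)))

  edgeless≤star : edgeless p ≤G star p
  edgeless≤star = (λ i → suc (suc i)) , Finₚ.suc-injective ∘ Finₚ.suc-injective , λ _ _ → refl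

  μ-edgeless-star : μ (edgeless p) (star p) ≡ - (count (not ∘ isCoatom) R ⊖ count isCoatom R)
  μ-edgeless-star = trans
    (μ′-unfold (suc (suc p)) {edgeless p} {star p}
      (<⇒¬iso? {edgeless p} {star p} (ℕₚ.m≤n⇒m≤1+n (ℕₚ.n<1+n p))) edgeless≤star)
    (cong -_ (sumℤ-signs _ isCoatom R coatom bottom))
    where
    coatom : ∀ {y} → y ∈ R → T (isCoatom y) → μ′ (suc (suc p)) (edgeless p) y ≡ - + 1
    coatom {y} y∈ c = μ′-coatom p {p} {y} (toWitness c) (proj₂ (above (nubIso-⊆ L {y} y∈)))
    bottom : ∀ {y} → y ∈ R → T (not (isCoatom y)) → μ′ (suc (suc p)) (edgeless p) y ≡ + 1
    bottom {y} y∈ ¬c = μ′-bottom (suc p) {p} {y} (bottom-size (nubIso-⊆ L y∈) ¬c)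
                         (proj₂ (above (nubIso-⊆ L {y} y∈)))

  bottoms≤1 : count (not ∘ isCoatom) R ≤ 1
  bottoms≤1 = nubIso-filter-length≤1 _ L λ {x} {y} x∈ y∈ ¬cx ¬cy → ≅⇒iso? x y
    (edgeless-≤G⇒≅ {p} {x} {y} (bottom-size x∈ ¬cx) (bottom-size y∈ ¬cy)
      (proj₂ (above x∈)) (proj₂ (above y∈)))

  leaves≤coatoms : suc p ≤ count isCoatom R
  leaves≤coatoms = witnesses⇒≤length MissesOnlyLeaf
    (λ {w} {w′} {y} → missesOnlyLeaf-unique {p} {w} {w′} {y}) witness
    where
    witness : ∀ w → Any (MissesOnlyLeaf w) (filterᵇ isCoatom R)
    witness w =
      let y , y∈ , iso = find (induced-represented (edgeless p) (star p)
                          (λ {i} {j} → Finₚ.punchIn-injective (suc w) i j) (ℕₚ.n<1+n (suc p))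
                          (suc , Finₚ.suc-injective , λ _ _ → refl))
          coatom = fromWitness (≡.sym (≅⇒≡ {starWithout p w} {y} iso))
      in lose (filterᵇ⁺ isCoatom y∈ coatom)
              (≅⇒missesOnlyLeaf {H = starWithout p w} {y} iso (starWithout-missesOnlyLeaf p w))

  p≤∣μ-edgeless-star∣ : p ≤ ∣ μ (edgeless p) (star p) ∣
  p≤∣μ-edgeless-star∣ = begin
    suc p ∸ 1                       ≤⟨ ℕₚ.∸-mono leaves≤coatoms bottoms≤1 ⟩
    coatoms ∸ bottoms               ≡⟨ ℤₚ.∣⊖∣-≤ bottoms≤coatoms ⟨
    ∣ bottoms ⊖ coatoms ∣           ≡⟨ ℤₚ.∣-i∣≡∣i∣ (bottoms ⊖ coatoms) ⟨
    ∣ - (bottoms ⊖ coatoms) ∣       ≡⟨ cong ∣_∣ μ-edgeless-star ⟨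
    ∣ μ (edgeless p) (star p) ∣     ∎
    where
    open ℕₚ.≤-Reasoning
    bottoms coatoms : ℕ
    bottoms = count (not ∘ isCoatom) R
    coatoms = count isCoatom R
    bottoms≤coatoms : bottoms ≤ coatoms
    bottoms≤coatoms = ℕₚ.≤-trans bottoms≤1 (ℕₚ.≤-trans (s≤s z≤n) leaves≤coatoms)

corollary4p2 : (N : ℕ) → Σ Graph λ H → Σ Graph λ G → H ≤G G × N < ∣ μ H G ∣
corollary4p2 N =
  edgeless (suc N) , star (suc N) , edgeless≤star (suc N) , p≤∣μ-edgeless-star∣ (suc N)
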